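{- Let $A$ be a minimally AP-irreducible sign pattern matrix of order $n$ all of whose diagonal entries are $0$. If, for any two distinct irreducible components $\alpha$ and $\beta$ of $A_+$, the submatrix $A[\alpha,\beta]$ contains no $+$, then $A$ has at most $2n-2$ nonzero entries. Consequently, at least two rows of $A$ and at least two columns of $A$ contain precisely one nonzero entry.
   Context: A sign pattern matrix has entries in $\{+,-,0\}$. Its digraph $D(A)$ has vertices $1,\ldots,n$ and an arc from $i$ to $j$ iff $a_{ij}\ne0$; $A$ is irreducible if $D(A)$ is strongly connected. Define $A_+$ by $(A_+)_{ij}=+$ if $a_{ij}=+$ and $0$ otherwise; $A_-$ by $(A_-)_{ij}=-$ if $a_{ij}=-$ and $0$ otherwise; and $B_A=A_+-(A_-)^T$ (so $(B_A)_{ij}=+$ if $a_{ij}=+$ or $a_{ji}=-$, in particular a sign pattern whose irreducibility depends only on its zero/nonzero structure). An irreducible sign pattern $A$ is AP-irreducible if every row and every column of $A$ contains a $+$ and $B_A$ is irreducible. $A$ is minimally AP-irreducible if it is AP-irreducible but replacing any single nonzero entry by $0$ yields a pattern that is not AP-irreducible. For $\alpha,\beta\subseteq\{1,\ldots,n\}$, $A[\alpha,\beta]$ is the submatrix with rows in $\alpha$ and columns in $\beta$, and $A[\alpha]=A[\alpha,\alpha]$. The irreducible components of a square pattern $M$ are the vertex sets of the strongly connected components of $D(M)$, i.e. the maximal sets $\alpha$ with $M[\alpha]$ irreducible (singletons included); they partition $\{1,\ldots,n\}$. -}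

module Defs where

open import Data.Nat using (ℕ; zero; suc; _+_)
open import Data.Fin using (Fin; _≟_)
open import Data.List using (List; map; allFin)
open import Data.Nat.ListAction using (sum)
open import Data.Product using (Σ; _×_; ∃)
open import Data.Bool using (true; false; _∧_; if_then_else_)
open import Relation.Nullary using (¬_)
open import Relation.Nullary.Decidable using (⌊_⌋)
open import Relation.Binary.PropositionalEquality using (_≡_; _≢_)
open import Relation.Binary.Construct.Closure.ReflexiveTransitive using (Star)

data Sign : Set where
  pos neg zer : Sign

Pattern : ℕ → Set
Pattern n = Fin n → Fin n → Sign

Arc : ∀ {n} → Pattern n → Fin n → Fin n → Set
Arc A i j = A i j ≢ zer

Reach : ∀ {n} → Pattern n → Fin n → Fin n → Set
Reach A = Star (Arc A)

Irreducible : ∀ {n} → Pattern n → Set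
Irreducible A = ∀ i j → Reach A i j

plusPart : ∀ {n} → Pattern n → Pattern n
plusPart A i j with A i j
... | pos = pos
... | _   = zer

minusPart : ∀ {n} → Pattern n → Pattern n
minusPart A i j with A i j
... | neg = neg
... | _   = zer

-- B_A = A₊ - (A₋)ᵀ : (B_A)_ij = + iff a_ij = + or a_ji = -
isPos : Sign → Data.Bool.Bool
isPos pos = true
isPos _   = false

isNeg : Sign → Data.Bool.Bool
isNeg neg = true
isNeg _   = false

B : ∀ {n} → Pattern n → Pattern n
B A i j = if isPos (plusPart A i j) Data.Bool.∨ isNeg (minusPart A j i) then pos else zer

APIrreducible : ∀ {n} → Pattern n → Set
APIrreducible {n} A =
  Irreducible A ×
  (∀ i → ∃ λ j → A i j ≡ pos) ×
  (∀ j → ∃ λ i → A i j ≡ pos) ×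
  Irreducible (B A)

setZero : ∀ {n} → Pattern n → Fin n → Fin n → Pattern n
setZero A i j k l = if ⌊ k ≟ i ⌋ ∧ ⌊ l ≟ j ⌋ then zer else A k l

MinimallyAPIrreducible : ∀ {n} → Pattern n → Set
MinimallyAPIrreducible A =
  APIrreducible A ×
  (∀ i j → A i j ≢ zer → ¬ APIrreducible (setZero A i j))

-- i and j lie in the same irreducible component of M
-- (same strongly connected component of D(M))
SameComponent : ∀ {n} → Pattern n → Fin n → Fin n → Set
SameComponent M i j = Reach M i j × Reach M j i

nz : Sign → ℕ
nz zer = 0
nz _   = 1

rowNonzeros : ∀ {n} → Pattern n → Fin n → ℕ
rowNonzeros {n} A i = sum (map (λ j → nz (A i j)) (allFin n))

colNonzeros : ∀ {n} → Pattern n → Fin n → ℕ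
colNonzeros {n} A j = sum (map (λ i → nz (A i j)) (allFin n))

nonzeros : ∀ {n} → Pattern n → ℕ
nonzeros {n} A = sum (map (rowNonzeros A) (allFin n))

-- Positive arcs never join distinct A₊-components, so the components, joined by the negative arcs between
-- them, form a strongly connected condensation. Keep, inside every component, an in-forest and an out-forest
-- of positive arcs rooted at its representative, and in the condensation an in-forest and an out-forest of
-- negative bridges rooted at the component of vertex zero: two arcs for every vertex other than zero. Zeroing
-- any entry outside these 2n − 2 arcs leaves A AP-irreducible, so by minimality A has no other nonzero entry.
-- As every row and column contains a +, the n row (column) counts are positive and sum to at most 2n − 2,
-- hence at least two of them equal 1.

module Submission where

open import Defs
open import Data.Nat using (ℕ; zero; suc; _+_; _*_; _∸_; _≤_; _<_; z≤n; s≤s; _≤?_) renaming (_≟_ to _≟ℕ_)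
open import Data.Nat.Properties
  using (+-*-semiring; ≤-trans; ≤-reflexive; ≤∧≢⇒<; ≮⇒≥; +-mono-≤; +-monoˡ-≤; +-monoʳ-≤;
         +-cancelˡ-≤; +-suc; m≤m+n; m≤n+m; *-identityʳ; *-comm; *-suc; m+n∸m≡n; module ≤-Reasoning)
open import Data.Nat.Induction using (<-rec; <-wellFounded)
open import Data.Nat.ListAction using () renaming (sum to listSum)
open import Data.Fin using (Fin; zero; suc; _≟_; combine; remQuot)
open import Data.Fin.Properties using (suc-injective; ∀-cons; any?; remQuot-combine)
open import Data.List using (map; allFin; tabulate)
open import Data.List.Properties using (map-tabulate)
open import Data.Product using (Σ-syntax; ∃; _×_; _,_; proj₁; proj₂; uncurry)
open import Data.Product.Properties using (≡-dec)
open import Data.Sum using (_⊎_; inj₁; inj₂)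
open import Function using (_∘_; flip; id)
open import Level using (0ℓ)
open import Effect.Monad using (RawMonad)
open import Induction.WellFounded using (module All)
open import Relation.Binary.Construct.On as On using ()
open import Relation.Nullary using (¬_; Dec; yes; no; contradiction)
open import Relation.Nullary.Decidable using (decidable-stable; ¬¬-excluded-middle; _⊎-dec_; ¬?)
open import Relation.Nullary.Negation using (¬¬-Monad)
open import Relation.Binary.PropositionalEquality
open import Relation.Binary.Construct.Closure.ReflexiveTransitive as Star
  using (Star; ε; _◅_; _◅◅_)
open import Algebra.Properties.Semiring.Sum +-*-semiring
  using (sum; sum-syntax; ∑-comm; sum-cong-≗; sum-replicate-zero; *-distribˡ-sum)

listSum-allFin : ∀ {n} (f : Fin n → ℕ) → listSum (map f (allFin n)) ≡ ∑[ i < n ] f i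
listSum-allFin f = trans (cong listSum (map-tabulate id f)) (listSum-tabulate f)
  where
  listSum-tabulate : ∀ {k} (g : Fin k → ℕ) → listSum (tabulate g) ≡ sum g
  listSum-tabulate {zero} g = refl
  listSum-tabulate {suc k} g = cong (g zero +_) (listSum-tabulate (g ∘ suc))

∑-mono-≤ : ∀ {n} {f g : Fin n → ℕ} → (∀ i → f i ≤ g i) → sum f ≤ sum g
∑-mono-≤ {zero} f≤g = z≤n
∑-mono-≤ {suc n} f≤g = +-mono-≤ (f≤g zero) (∑-mono-≤ (f≤g ∘ suc))

term-≤-∑ : ∀ {n} (f : Fin n → ℕ) i → f i ≤ sum f
term-≤-∑ f zero = m≤m+n (f zero) _
term-≤-∑ f (suc i) = ≤-trans (term-≤-∑ (f ∘ suc) i) (m≤n+m _ (f zero))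

∑-one : ∀ k → ∑[ t < k ] 1 ≡ k
∑-one zero = refl
∑-one (suc k) = cong suc (∑-one k)

δ : ∀ {n} → Fin n → Fin n → ℕ
δ zero zero = 1
δ zero (suc _) = 0
δ (suc _) zero = 0
δ (suc a) (suc b) = δ a b

δ-refl : ∀ {n} (a : Fin n) → δ a a ≡ 1
δ-refl zero = refl
δ-refl (suc a) = δ-refl a

∑-δ : ∀ {n} (a : Fin n) → ∑[ i < n ] δ a i ≡ 1
∑-δ {suc n} zero = cong suc (sum-replicate-zero n)
∑-δ {suc n} (suc a) = ∑-δ a

∑∑-δδ : ∀ {n} (a b : Fin n) → ∑[ i < n ] ∑[ j < n ] (δ a i * δ b j) ≡ 1
∑∑-δδ {n} a b = begin
  ∑[ i < n ] ∑[ j < n ] (δ a i * δ b j)  ≡⟨ sum-cong-≗ (λ i → *-distribˡ-sum (δ a i) (δ b)) ⟨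
  ∑[ i < n ] (δ a i * ∑[ j < n ] δ b j)  ≡⟨ sum-cong-≗ (λ i → cong (δ a i *_) (∑-δ b)) ⟩
  ∑[ i < n ] (δ a i * 1)                 ≡⟨ sum-cong-≗ (λ i → *-identityʳ (δ a i)) ⟩
  ∑[ i < n ] δ a i                       ≡⟨ ∑-δ a ⟩
  1                                      ∎
  where open ≡-Reasoning

nz-≤-1 : ∀ s → nz s ≤ 1
nz-≤-1 pos = s≤s z≤n
nz-≤-1 neg = s≤s z≤n
nz-≤-1 zer = z≤n

nz-≢zer : ∀ {s} → s ≢ zer → 1 ≤ nz s
nz-≢zer {pos} _ = s≤s z≤n
nz-≢zer {neg} _ = s≤s z≤n
nz-≢zer {zer} s≢zer = contradiction refl s≢zer

nz-≤ : ∀ s {x} → (s ≢ zer → 1 ≤ x) → nz s ≤ x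
nz-≤ zer _ = z≤n
nz-≤ s@pos h = ≤-trans (nz-≤-1 s) (h (λ ()))
nz-≤ s@neg h = ≤-trans (nz-≤-1 s) (h (λ ()))

entryCount : ∀ {n} → Pattern n → ℕ
entryCount {n} A = ∑[ i < n ] ∑[ j < n ] nz (A i j)

rowNonzeros-∑ : ∀ {n} (A : Pattern n) i → rowNonzeros A i ≡ ∑[ j < n ] nz (A i j)
rowNonzeros-∑ A i = listSum-allFin (λ j → nz (A i j))

colNonzeros-∑ : ∀ {n} (A : Pattern n) j → colNonzeros A j ≡ ∑[ i < n ] nz (A i j)
colNonzeros-∑ A j = listSum-allFin (λ i → nz (A i j))

∑-rowNonzeros : ∀ {n} (A : Pattern n) → ∑[ i < n ] rowNonzeros A i ≡ entryCount A
∑-rowNonzeros A = sum-cong-≗ (rowNonzeros-∑ A)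

∑-colNonzeros : ∀ {n} (A : Pattern n) → ∑[ j < n ] colNonzeros A j ≡ entryCount A
∑-colNonzeros A = trans (sum-cong-≗ (colNonzeros-∑ A)) (∑-comm (λ j i → nz (A i j)))

nonzeros≡entryCount : ∀ {n} (A : Pattern n) → nonzeros A ≡ entryCount A
nonzeros≡entryCount A = trans (listSum-allFin (rowNonzeros A)) (∑-rowNonzeros A)

-- Each entry is bounded by the number of times it is hit, and each arc hits exactly one entry.
entryCount-≤-cover : ∀ {n k} (A : Pattern n) (arc : Fin k → Fin n × Fin n) →
  (∀ i j → A i j ≢ zer → ∃ λ t → arc t ≡ (i , j)) → entryCount A ≤ k
entryCount-≤-cover {n} {k} A arc cover = begin
  ∑[ i < n ] ∑[ j < n ] nz (A i j)             ≤⟨ ∑-mono-≤ (λ i → ∑-mono-≤ (λ j → nz-≤ (A i j) (hit-≥1 ∘ cover i j))) ⟩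
  ∑[ i < n ] ∑[ j < n ] ∑[ t < k ] hit t i j   ≡⟨ sum-cong-≗ (λ i → ∑-comm (λ j t → hit t i j)) ⟩
  ∑[ i < n ] ∑[ t < k ] ∑[ j < n ] hit t i j   ≡⟨ ∑-comm (λ i t → ∑[ j < n ] hit t i j) ⟩
  ∑[ t < k ] ∑[ i < n ] ∑[ j < n ] hit t i j   ≡⟨ sum-cong-≗ (λ t → ∑∑-δδ (proj₁ (arc t)) (proj₂ (arc t))) ⟩
  ∑[ t < k ] 1                                 ≡⟨ ∑-one k ⟩
  k                                            ∎
  where
  open ≤-Reasoning
  hit : Fin k → Fin n → Fin n → ℕ
  hit t i j = δ (proj₁ (arc t)) i * δ (proj₂ (arc t)) j

  hit-≥1 : ∀ {i j} → ∃ (λ t → arc t ≡ (i , j)) → 1 ≤ ∑[ t < k ] hit t i j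
  hit-≥1 {i} {j} (t , refl) =
    ≤-trans (≤-reflexive (sym (cong₂ _*_ (δ-refl i) (δ-refl j)))) (term-≤-∑ (λ t → hit t i j) t)

drop-head : ∀ c {x s b} → 2 ≤ x → c + (x + s) ≤ 2 + b → c + s ≤ b
drop-head c {x} {s} {b} 2≤x le = +-cancelˡ-≤ 2 _ _ (begin
  2 + (c + s)  ≡⟨ cong suc (+-suc c s) ⟨
  suc (c + suc s) ≡⟨ +-suc c (suc s) ⟨
  c + (2 + s)  ≤⟨ +-monoʳ-≤ c (+-monoˡ-≤ s 2≤x) ⟩
  c + (x + s)  ≤⟨ le ⟩
  2 + b        ∎)
  where open ≤-Reasoning

∃-≡1 : ∀ {n} (f : Fin n → ℕ) → (∀ i → 1 ≤ f i) → 1 + sum f ≤ n * 2 → ∃ λ i → f i ≡ 1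
∃-≡1 {suc n} f f≥1 bound with f zero ≟ℕ 1
... | yes f₀≡1 = zero , f₀≡1
... | no f₀≢1 =
  let i , fi≡1 = ∃-≡1 (f ∘ suc) (f≥1 ∘ suc) (drop-head 1 (≤∧≢⇒< (f≥1 zero) (f₀≢1 ∘ sym)) bound)
  in suc i , fi≡1

∃₂-≡1 : ∀ {n} (f : Fin n → ℕ) → (∀ i → 1 ≤ f i) → 2 + sum f ≤ n * 2 →
  Σ[ a ∈ Fin n ] Σ[ b ∈ Fin n ] a ≢ b × f a ≡ 1 × f b ≡ 1
∃₂-≡1 {suc n} f f≥1 bound with f zero ≟ℕ 1
... | yes f₀≡1 =
  let i , fi≡1 = ∃-≡1 (f ∘ suc) (f≥1 ∘ suc)
                 (+-cancelˡ-≤ 2 _ _ (subst (λ x → 2 + (x + sum (f ∘ suc)) ≤ suc n * 2) f₀≡1 bound))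
  in zero , suc i , (λ ()) , f₀≡1 , fi≡1
... | no f₀≢1 =
  let a , b , a≢b , fa≡1 , fb≡1 = ∃₂-≡1 (f ∘ suc) (f≥1 ∘ suc) (drop-head 2 (≤∧≢⇒< (f≥1 zero) (f₀≢1 ∘ sym)) bound)
  in suc a , suc b , a≢b ∘ suc-injective , fa≡1 , fb≡1

open RawMonad (¬¬-Monad {0ℓ}) using (pure; _>>=_)

¬¬-Π : ∀ {n} {P : Fin n → Set} → (∀ i → ¬ ¬ P i) → ¬ ¬ (∀ i → P i)
¬¬-Π {zero} _ = pure λ ()
¬¬-Π {suc n} h = do
  p₀ ← h zero
  ps ← ¬¬-Π (h ∘ suc)
  pure (∀-cons p₀ ps)

Least : (ℕ → Set) → Set
Least P = ∃ λ k → P k × (∀ {j} → j < k → ¬ P j)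

¬¬-least : ∀ {P : ℕ → Set} k → P k → ¬ ¬ Least P
¬¬-least {P} = <-rec (λ k → P k → ¬ ¬ Least P) step
  where
  step : ∀ k → (∀ {j} → j < k → P j → ¬ ¬ Least P) → P k → ¬ ¬ Least P
  step k ih pk = do
    yes (j , j<k , pj) ← ¬¬-excluded-middle {A = ∃ λ j → j < k × P j}
      where no none → pure (k , pk , λ {j} j<k pj → none (j , j<k , pj))
    ih j<k pj

module _ {n} (E : Fin n → Fin n → Set) (R : Fin n → Set) where

  data Reached : ℕ → Fin n → Set where
    start : ∀ {v} → R v → Reached 0 v
    _▸_   : ∀ {k u v} → Reached k u → E u v → Reached (suc k) v

  record SpanningForest : Set where
    field
      rank        : Fin n → ℕ
      parent      : Fin n → Fin n
      parent-edge : ∀ {v} → ¬ R v → E (parent v) v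
      parent-rank : ∀ {v} → ¬ R v → rank (parent v) < rank v

    induction : (∀ v → Dec (R v)) → (Q : Fin n → Set) →
      (∀ {v} → R v → Q v) → (∀ {v} → ¬ R v → Q (parent v) → Q v) → ∀ v → Q v
    induction R? Q base step = All.wfRec (On.wellFounded rank <-wellFounded) 0ℓ Q go
      where
      go : ∀ v → (∀ {u} → rank u < rank v → Q u) → Q v
      go v ih with R? v
      ... | yes r = base r
      ... | no ¬r = step ¬r (ih (parent-rank ¬r))

  -- Ranks are shortest distances from R; the parent of v is its predecessor on a shortest walk.
  spanningForest : (∀ v → ∃ λ u → R u × Star E u v) → ¬ ¬ SpanningForest
  spanningForest reach = do
    shortest ← ¬¬-Π (λ v → let k , w = reached (reach v) in ¬¬-least k w)
    pure (forest shortest)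
    where
    extend : ∀ {k u v} → Reached k u → Star E u v → ∃ λ k′ → Reached k′ v
    extend w ε = _ , w
    extend w (e ◅ es) = extend (w ▸ e) es

    reached : ∀ {v} → (∃ λ u → R u × Star E u v) → ∃ λ k → Reached k v
    reached (u , r , path) = extend (start r) path

    predecessor : ∀ {k v} → Reached k v → Fin n
    predecessor (start {v} _) = v
    predecessor (_▸_ {u = u} _ _) = u

    forest : (∀ v → Least (λ k → Reached k v)) → SpanningForest
    forest shortest = record
      { rank = rank ; parent = parent ; parent-edge = parent-edge ; parent-rank = parent-rank }
      where
      rank : Fin n → ℕ
      rank v = proj₁ (shortest v)

      parent : Fin n → Fin n
      parent v = predecessor (proj₁ (proj₂ (shortest v)))

      parent-edge : ∀ {v} → ¬ R v → E (parent v) v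
      parent-edge {v} ¬r with shortest v
      ... | _ , start r , _ = contradiction r ¬r
      ... | _ , _ ▸ e , _ = e

      parent-rank : ∀ {v} → ¬ R v → rank (parent v) < rank v
      parent-rank {v} ¬r with shortest v
      ... | _ , start r , _ = contradiction r ¬r
      ... | suc j , _▸_ {u = u} w _ , _ = s≤s (≮⇒≥ (λ j<rank → proj₂ (proj₂ (shortest u)) j<rank w))

first : ∀ {n} {P : Fin n → Set} → (∀ i → Dec (P i)) → ∃ P → ∃ P
first {suc n} P? witness with P? zero
... | yes p₀ = zero , p₀
... | no ¬p₀ = let i , p = first (P? ∘ suc) (shift witness) in suc i , p
  where
  shift : ∃ _ → ∃ _
  shift (zero , p₀) = contradiction p₀ ¬p₀
  shift (suc i , p) = i , p

first-cong : ∀ {n} {P Q : Fin n → Set} (P? : ∀ i → Dec (P i)) (Q? : ∀ i → Dec (Q i)) p q →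
  (∀ {i} → P i → Q i) → (∀ {i} → Q i → P i) → proj₁ (first P? p) ≡ proj₁ (first Q? q)
first-cong {suc n} P? Q? p q P⇒Q Q⇒P with P? zero | Q? zero
... | yes _  | yes _  = refl
... | yes p₀ | no ¬q₀ = contradiction (P⇒Q p₀) ¬q₀
... | no ¬p₀ | yes q₀ = contradiction (Q⇒P q₀) ¬p₀
... | no _   | no _   = cong suc (first-cong (P? ∘ suc) (Q? ∘ suc) _ _ P⇒Q Q⇒P)

first-zero : ∀ {n} {P : Fin (suc n) → Set} (P? : ∀ i → Dec (P i)) p → P zero → proj₁ (first P? p) ≡ zero
first-zero P? p p₀ with P? zero
... | yes _ = refl
... | no ¬p₀ = contradiction p₀ ¬p₀

≡pos⇒≢zer : ∀ {s} → s ≡ pos → s ≢ zer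
≡pos⇒≢zer refl ()

≡neg⇒≢zer : ∀ {s} → s ≡ neg → s ≢ zer
≡neg⇒≢zer refl ()

≢zer⇒pos⊎neg : ∀ {s} → s ≢ zer → s ≡ pos ⊎ s ≡ neg
≢zer⇒pos⊎neg {pos} _ = inj₁ refl
≢zer⇒pos⊎neg {neg} _ = inj₂ refl
≢zer⇒pos⊎neg {zer} s≢zer = contradiction refl s≢zer

PosArc : ∀ {n} → Pattern n → Fin n → Fin n → Set
PosArc A a b = A a b ≡ pos

plusPart-arc : ∀ {n} (A : Pattern n) {a b} → Arc (plusPart A) a b → PosArc A a b
plusPart-arc A {a} {b} arc with A a b
... | pos = refl
... | neg = contradiction refl arc
... | zer = contradiction refl arc

B-pos : ∀ {n} (A : Pattern n) {a b} → A a b ≡ pos → Arc (B A) a b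
B-pos A {a} {b} e rewrite e = λ ()

B-neg : ∀ {n} (A : Pattern n) {a b} → A b a ≡ neg → Arc (B A) a b
B-neg A {a} {b} e with A a b
... | pos = λ ()
... | neg rewrite e = λ ()
... | zer rewrite e = λ ()

setZero-pos : ∀ {n} (A : Pattern n) i j {a b} → setZero A i j a b ≡ pos → A a b ≡ pos
setZero-pos A i j {a} {b} e with a ≟ i | b ≟ j
... | yes _ | yes _ = contradiction e λ ()
... | yes _ | no _ = e
... | no _  | _ = e

setZero-≢ : ∀ {n} (A : Pattern n) i j p → p ≢ (i , j) → uncurry (setZero A i j) p ≡ uncurry A p
setZero-≢ A i j (a , b) p≢ij with a ≟ i | b ≟ j
... | yes a≡i | yes b≡j = contradiction (cong₂ _,_ a≡i b≡j) p≢ij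
... | yes _ | no _ = refl
... | no _  | _ = refl

firstStep : ∀ {n} {T : Fin n → Fin n → Set} {u w} → Star T u w → u ≢ w → ∃ (T u)
firstStep ε u≢w = contradiction refl u≢w
firstStep (e ◅ _) _ = _ , e

lastStep : ∀ {n} {T : Fin n → Fin n → Set} {u w} → Star T u w → u ≢ w → ∃ λ x → T x w
lastStep path u≢w = firstStep (Star.reverse id path) (u≢w ∘ sym)

module Skeleton {m} (A : Pattern (suc m))
  (comp? : ∀ u v → Dec (Star (PosArc A) u v))
  (reversible : ∀ u v → PosArc A u v → Star (PosArc A) v u) where

  private
    n : ℕ
    n = suc m

  Comp : Fin n → Fin n → Set
  Comp = Star (PosArc A)

  comp-sym : ∀ {u v} → Comp u v → Comp v u
  comp-sym ε = ε
  comp-sym (e ◅ es) = comp-sym es ◅◅ reversible _ _ e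

  rep : Fin n → Fin n
  rep v = proj₁ (first (comp? v) (v , ε))

  comp-rep : ∀ v → Comp v (rep v)
  comp-rep v = proj₂ (first (comp? v) (v , ε))

  rep-cong : ∀ {u v} → Comp u v → rep u ≡ rep v
  rep-cong u~v = first-cong (comp? _) (comp? _) _ _ (comp-sym u~v ◅◅_) (u~v ◅◅_)

  rep-idem : ∀ v → rep (rep v) ≡ rep v
  rep-idem v = rep-cong (comp-sym (comp-rep v))

  rep-zero : rep zero ≡ zero
  rep-zero = first-zero (comp? zero) _ ε

  IsRep : Fin n → Set
  IsRep v = rep v ≡ v

  rep-reaches : ∀ v → ∃ λ u → IsRep u × Comp u v
  rep-reaches v = rep v , rep-idem v , comp-sym (comp-rep v)

  reaches-rep : ∀ v → ∃ λ u → IsRep u × Star (flip (PosArc A)) u v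
  reaches-rep v = rep v , rep-idem v , Star.reverse id (comp-rep v)

  Bridge : Fin n × Fin n → Fin n → Fin n → Set
  Bridge (a , b) x y = A a b ≡ neg × rep a ≡ x × rep b ≡ y

  bridge-tail-rep : ∀ {p x y} → Bridge p x y → IsRep x
  bridge-tail-rep {a , _} (_ , refl , _) = rep-idem a

  bridge-head-rep : ∀ {p x y} → Bridge p x y → IsRep y
  bridge-head-rep {_ , b} (_ , _ , refl) = rep-idem b

  QuotArc : Fin n → Fin n → Set
  QuotArc x y = ∃ λ p → Bridge p x y

  -- The condensation lives on representatives; making the other vertices roots means they need no arc there.
  QuotRoot : Fin n → Set
  QuotRoot x = x ≡ zero ⊎ ¬ IsRep x

  quotRoot? : ∀ x → Dec (QuotRoot x)
  quotRoot? x = (x ≟ zero) ⊎-dec ¬? (rep x ≟ x)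

  quotient-walk : ∀ {a b} → Reach A a b → Star QuotArc (rep a) (rep b)
  quotient-walk ε = ε
  quotient-walk {a} (_◅_ {j = x} arc walk) with ≢zer⇒pos⊎neg arc
  ... | inj₁ positive = subst (λ y → Star QuotArc y _) (sym (rep-cong (positive ◅ ε))) (quotient-walk walk)
  ... | inj₂ negative = ((a , x) , negative , refl , refl) ◅ quotient-walk walk

  module _ (irr : Irreducible A) where

    quotRoot-reaches : ∀ v → ∃ λ u → QuotRoot u × Star QuotArc u v
    quotRoot-reaches v with rep v ≟ v
    ... | no ¬rep = v , inj₂ ¬rep , ε
    ... | yes rep-v = zero , inj₁ refl , subst₂ (Star QuotArc) rep-zero rep-v (quotient-walk (irr zero v))

    reaches-quotRoot : ∀ v → ∃ λ u → QuotRoot u × Star (flip QuotArc) u v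
    reaches-quotRoot v with rep v ≟ v
    ... | no ¬rep = v , inj₂ ¬rep , ε
    ... | yes rep-v = zero , inj₁ refl ,
      Star.reverse id (subst₂ (Star QuotArc) rep-v rep-zero (quotient-walk (irr v zero)))

  -- Every vertex other than zero keeps one arc into it and one arc out of it: a forest arc inside its
  -- A₊-component if it is not a representative, and a bridge of the condensation forests otherwise.
  module KeptArcs (F₊ : SpanningForest (PosArc A) IsRep) (F₋ : SpanningForest (flip (PosArc A)) IsRep)
              (G₊ : SpanningForest QuotArc QuotRoot) (G₋ : SpanningForest (flip QuotArc) QuotRoot) where
    open SpanningForest using (parent; parent-edge; induction)

    inArc : Fin n → Fin n × Fin n
    inArc v with quotRoot? v
    ... | yes _ = parent F₊ v , v
    ... | no ¬root = proj₁ (parent-edge G₊ ¬root)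

    outArc : Fin n → Fin n × Fin n
    outArc v with quotRoot? v
    ... | yes _ = v , parent F₋ v
    ... | no ¬root = proj₁ (parent-edge G₋ ¬root)

    inArc-within : ∀ {v} → ¬ IsRep v → inArc v ≡ (parent F₊ v , v)
    inArc-within {v} ¬rep with quotRoot? v
    ... | yes _ = refl
    ... | no ¬root = contradiction (inj₂ ¬rep) ¬root

    outArc-within : ∀ {v} → ¬ IsRep v → outArc v ≡ (v , parent F₋ v)
    outArc-within {v} ¬rep with quotRoot? v
    ... | yes _ = refl
    ... | no ¬root = contradiction (inj₂ ¬rep) ¬root

    inArc-bridge : ∀ {v} → ¬ QuotRoot v → Bridge (inArc v) (parent G₊ v) v
    inArc-bridge {v} ¬root with quotRoot? v
    ... | yes root = contradiction root ¬root
    ... | no ¬root′ = proj₂ (parent-edge G₊ ¬root′)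

    outArc-bridge : ∀ {v} → ¬ QuotRoot v → Bridge (outArc v) v (parent G₋ v)
    outArc-bridge {v} ¬root with quotRoot? v
    ... | yes root = contradiction root ¬root
    ... | no ¬root′ = proj₂ (parent-edge G₋ ¬root′)

    arcOf : Fin m × Fin 2 → Fin n × Fin n
    arcOf (k , zero) = inArc (suc k)
    arcOf (k , suc _) = outArc (suc k)

    keptArc : Fin (m * 2) → Fin n × Fin n
    keptArc t = arcOf (remQuot 2 t)

    Kept : Fin n × Fin n → Set
    Kept p = ∃ λ t → keptArc t ≡ p

    inArc-kept : ∀ {v} → v ≢ zero → Kept (inArc v)
    inArc-kept {zero} v≢0 = contradiction refl v≢0
    inArc-kept {suc k} _ = combine k zero , cong arcOf (remQuot-combine k zero)

    outArc-kept : ∀ {v} → v ≢ zero → Kept (outArc v)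
    outArc-kept {zero} v≢0 = contradiction refl v≢0
    outArc-kept {suc k} _ = combine k (suc zero) , cong arcOf (remQuot-combine k (suc zero))

    ¬rep⇒≢zero : ∀ {v} → ¬ IsRep v → v ≢ zero
    ¬rep⇒≢zero ¬rep refl = ¬rep rep-zero

    module _ (A′ : Pattern n) (pos⇒pos : ∀ {a b} → A′ a b ≡ pos → A a b ≡ pos)
             (keeps : ∀ {p} → Kept p → uncurry A′ p ≡ uncurry A p) where

      Comp′ : Fin n → Fin n → Set
      Comp′ = Star (PosArc A′)

      pos-reach : ∀ {u v} → Comp′ u v → Reach A′ u v
      pos-reach = Star.map ≡pos⇒≢zer

      comp-from-rep : ∀ v → Comp′ (rep v) v
      comp-from-rep = induction F₊ (λ v → rep v ≟ v) (λ v → Comp′ (rep v) v) base step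
        where
        base : ∀ {v} → IsRep v → Comp′ (rep v) v
        base rep-v = subst (λ x → Comp′ x _) (sym rep-v) ε

        step : ∀ {v} → ¬ IsRep v → Comp′ (rep (parent F₊ v)) (parent F₊ v) → Comp′ (rep v) v
        step ¬rep path = subst (λ x → Comp′ x _) (rep-cong (parent-edge F₊ ¬rep ◅ ε))
          (path ◅◅ trans (keeps (subst Kept (inArc-within ¬rep) (inArc-kept (¬rep⇒≢zero ¬rep))))
                         (parent-edge F₊ ¬rep) ◅ ε)

      comp-to-rep : ∀ v → Comp′ v (rep v)
      comp-to-rep = induction F₋ (λ v → rep v ≟ v) (λ v → Comp′ v (rep v)) base step
        where
        base : ∀ {v} → IsRep v → Comp′ v (rep v)
        base rep-v = subst (Comp′ _) (sym rep-v) ε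

        step : ∀ {v} → ¬ IsRep v → Comp′ (parent F₋ v) (rep (parent F₋ v)) → Comp′ v (rep v)
        step ¬rep path = subst (Comp′ _) (sym (rep-cong (parent-edge F₋ ¬rep ◅ ε)))
          (trans (keeps (subst Kept (outArc-within ¬rep) (outArc-kept (¬rep⇒≢zero ¬rep))))
                 (parent-edge F₋ ¬rep) ◅ path)

      linked : ∀ {u v} → rep u ≡ rep v → Comp′ u v
      linked {u} {v} same = comp-to-rep u ◅◅ subst (λ x → Comp′ x v) (sym same) (comp-from-rep v)

      bridge-reach : ∀ {p x y} → Kept p → Bridge p x y → Reach A′ x y
      bridge-reach {a , b} kept (negative , refl , refl) =
        pos-reach (comp-from-rep a) ◅◅ ≡neg⇒≢zer (trans (keeps kept) negative) ◅ pos-reach (comp-to-rep b)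

      zero-reaches-rep : ∀ x → IsRep x → Reach A′ zero x
      zero-reaches-rep = induction G₊ quotRoot? (λ x → IsRep x → Reach A′ zero x) base step
        where
        base : ∀ {x} → QuotRoot x → IsRep x → Reach A′ zero x
        base (inj₁ refl) _ = ε
        base (inj₂ ¬rep) rep-x = contradiction rep-x ¬rep

        step : ∀ {x} → ¬ QuotRoot x → (IsRep (parent G₊ x) → Reach A′ zero (parent G₊ x)) →
          IsRep x → Reach A′ zero x
        step ¬root ih _ = ih (bridge-tail-rep (inArc-bridge ¬root))
          ◅◅ bridge-reach (inArc-kept (¬root ∘ inj₁)) (inArc-bridge ¬root)

      rep-reaches-zero : ∀ x → IsRep x → Reach A′ x zero
      rep-reaches-zero = induction G₋ quotRoot? (λ x → IsRep x → Reach A′ x zero) base step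
        where
        base : ∀ {x} → QuotRoot x → IsRep x → Reach A′ x zero
        base (inj₁ refl) _ = ε
        base (inj₂ ¬rep) rep-x = contradiction rep-x ¬rep

        step : ∀ {x} → ¬ QuotRoot x → (IsRep (parent G₋ x) → Reach A′ (parent G₋ x) zero) →
          IsRep x → Reach A′ x zero
        step ¬root ih _ = bridge-reach (outArc-kept (¬root ∘ inj₁)) (outArc-bridge ¬root)
          ◅◅ ih (bridge-head-rep (outArc-bridge ¬root))

      irreducible : Irreducible A′
      irreducible u v = pos-reach (comp-to-rep u)
        ◅◅ rep-reaches-zero (rep u) (rep-idem u)
        ◅◅ zero-reaches-rep (rep v) (rep-idem v)
        ◅◅ pos-reach (comp-from-rep v)

      -- Positive arcs of A′ stay inside A₊-components, so each can be undone by a positive path of A′.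
      arc-reversed : ∀ {a b} → Arc A′ a b → Reach (B A′) b a
      arc-reversed arc with ≢zer⇒pos⊎neg arc
      ... | inj₁ positive = Star.map (B-pos A′) (linked (sym (rep-cong (pos⇒pos positive ◅ ε))))
      ... | inj₂ negative = B-neg A′ negative ◅ ε

      B-irreducible : Irreducible (B A′)
      B-irreducible u v = Star.concat (Star.reverse arc-reversed (irreducible v u))

      apIrreducible : (∀ i → A i i ≡ zer) →
        (∀ u → ∃ λ w → A u w ≡ pos) → (∀ w → ∃ λ u → A u w ≡ pos) → APIrreducible A′
      apIrreducible diag rowP colP =
        irreducible ,
        (λ u → let w , e = rowP u in firstStep (linked (rep-cong (e ◅ ε))) (irreflexive e)) ,
        (λ w → let u , e = colP w in lastStep (linked (rep-cong (e ◅ ε))) (irreflexive e)) ,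
        B-irreducible
        where
        irreflexive : ∀ {u w} → A u w ≡ pos → u ≢ w
        irreflexive {u} e refl = contradiction (trans (sym e) (diag u)) λ ()

    entryCount-≤ : (∀ i j → A i j ≢ zer → ¬ APIrreducible (setZero A i j)) → (∀ i → A i i ≡ zer) →
      (∀ u → ∃ λ w → A u w ≡ pos) → (∀ w → ∃ λ u → A u w ≡ pos) → entryCount A ≤ m * 2
    entryCount-≤ minimal diag rowP colP = entryCount-≤-cover A keptArc covered
      where
      covered : ∀ i j → A i j ≢ zer → ∃ λ t → keptArc t ≡ (i , j)
      covered i j nonzero with any? (λ t → ≡-dec _≟_ _≟_ (keptArc t) (i , j))
      ... | yes hit = hit
      ... | no miss = contradiction
        (apIrreducible (setZero A i j) (setZero-pos A i j) keeps diag rowP colP) (minimal i j nonzero)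
        where
        keeps : ∀ {p} → Kept p → uncurry (setZero A i j) p ≡ uncurry A p
        keeps (t , refl) = setZero-≢ A i j (keptArc t) (λ hit → miss (t , hit))

posArc-reversible : ∀ {n} (A : Pattern n) → (∀ u v → Dec (Star (PosArc A) u v)) →
  (∀ i j → ¬ SameComponent (plusPart A) i j → A i j ≢ pos) →
  ∀ u v → PosArc A u v → Star (PosArc A) v u
posArc-reversible A comp? sameComponent u v e with comp? v u
... | yes back = back
... | no ¬back = contradiction e (sameComponent u v (¬back ∘ Star.map (plusPart-arc A) ∘ proj₂))

-- Classical choices (reachability in A₊ and shortest-path forests) are harmless: the conclusion is decidable.
minimallyAPIrreducible-entryCount : ∀ {m} (A : Pattern (suc m)) → MinimallyAPIrreducible A →
  (∀ i → A i i ≡ zer) → (∀ i j → ¬ SameComponent (plusPart A) i j → A i j ≢ pos) →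
  entryCount A ≤ m * 2
minimallyAPIrreducible-entryCount A ((irr , rowP , colP , _) , minimal) diag sameComponent =
  decidable-stable (_ ≤? _) do
    comp? ← ¬¬-Π λ u → ¬¬-Π λ v → ¬¬-excluded-middle
    let open Skeleton A comp? (posArc-reversible A comp? sameComponent)
    F₊ ← spanningForest _ _ rep-reaches
    F₋ ← spanningForest _ _ reaches-rep
    G₊ ← spanningForest _ _ (quotRoot-reaches irr)
    G₋ ← spanningForest _ _ (reaches-quotRoot irr)
    pure (KeptArcs.entryCount-≤ F₊ F₋ G₊ G₋ minimal diag rowP colP)

rowNonzeros-≥1 : ∀ {n} (A : Pattern n) {i j} → A i j ≢ zer → 1 ≤ rowNonzeros A i
rowNonzeros-≥1 A {i} {j} nonzero =
  ≤-trans (nz-≢zer nonzero) (≤-trans (term-≤-∑ (λ j → nz (A i j)) j) (≤-reflexive (sym (rowNonzeros-∑ A i))))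

colNonzeros-≥1 : ∀ {n} (A : Pattern n) {i j} → A i j ≢ zer → 1 ≤ colNonzeros A j
colNonzeros-≥1 A {i} {j} nonzero =
  ≤-trans (nz-≢zer nonzero) (≤-trans (term-≤-∑ (λ i → nz (A i j)) i) (≤-reflexive (sym (colNonzeros-∑ A j))))

m*2≡2[1+m]∸2 : ∀ m → m * 2 ≡ 2 * suc m ∸ 2
m*2≡2[1+m]∸2 m = trans (*-comm m 2) (sym (trans (cong (_∸ 2) (*-suc 2 m)) (m+n∸m≡n 2 (2 * m))))

lemma3p11 : (m : ℕ) → let n = suc m in (A : Pattern n) →
    MinimallyAPIrreducible A →
    (∀ i → A i i ≡ zer) →
    (∀ i j → ¬ SameComponent (plusPart A) i j → A i j ≢ pos) →
    (nonzeros A ≤ 2 * n ∸ 2) ×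
    (Σ[ r₁ ∈ Fin n ] Σ[ r₂ ∈ Fin n ] r₁ ≢ r₂ × rowNonzeros A r₁ ≡ 1 × rowNonzeros A r₂ ≡ 1) ×
    (Σ[ c₁ ∈ Fin n ] Σ[ c₂ ∈ Fin n ] c₁ ≢ c₂ × colNonzeros A c₁ ≡ 1 × colNonzeros A c₂ ≡ 1)
lemma3p11 m A minAP@((_ , rowP , colP , _) , _) diag sameComponent =
  subst₂ _≤_ (sym (nonzeros≡entryCount A)) (m*2≡2[1+m]∸2 m) bound ,
  ∃₂-≡1 (rowNonzeros A) (λ i → rowNonzeros-≥1 A (≡pos⇒≢zer (proj₂ (rowP i))))
    (s≤s (s≤s (subst (_≤ m * 2) (sym (∑-rowNonzeros A)) bound))) ,
  ∃₂-≡1 (colNonzeros A) (λ j → colNonzeros-≥1 A (≡pos⇒≢zer (proj₂ (colP j))))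
    (s≤s (s≤s (subst (_≤ m * 2) (sym (∑-colNonzeros A)) bound)))
  where
  bound : entryCount A ≤ m * 2
  bound = minimallyAPIrreducible-entryCount A minAP diag sameComponent
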